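{- Let $G=(V,A)$ be a directed acyclic graph, $L\subseteq V$ a set of ranked vertices and $r:V\to\mathbb{Z}^+\cup\{\infty\}$ injective on $L$ with $r=\infty$ on $V\setminus L$. Let $u,v\in V$. If $\rho(u)>_{\mathrm{lex}}\rho(v)$, then there is no directed path from $v$ to $u$ in $G$.
   Context: For a vertex $v$, $P(v)$ is the set of vertices $u$ such that there is a directed path from $u$ to $v$, and $S(v)$ the set of vertices $u$ with a directed path from $v$ to $u$; $v\in P(v)\cap S(v)$. Let $D(u,v)=S(u)\cap P(v)$. Define $A_1(v)=P(v)\cap L$; for $i\ge1$, if $A_i(v)\ne\emptyset$, let $\ell_i(v)$ be the vertex of $A_i(v)$ of minimum rank and $A_{i+1}(v)=(D(\ell_i(v),v)\setminus\{\ell_i(v)\})\cap L$. Let $k(v)=0$ if $A_1(v)=\emptyset$ and otherwise the largest $i$ with $A_i(v)\ne\emptyset$. The label of $v$ is $\ell(v)=(\ell_1(v),\ldots,\ell_{k(v)}(v))$ and its rank sequence is $\rho(v)=(r(\ell_1(v)),\ldots,r(\ell_{k(v)}(v)),+\infty)$. Rank sequences are compared lexicographically ($>_{\mathrm{lex}}$), with $+\infty$ larger than every integer. Equivalently, $\rho(u)>_{\mathrm{lex}}\rho(v)$ holds iff either (1) for some $1\le i\le k(u)$, $r(\ell_i(u))>r(\ell_i(v))$ and $\ell_j(u)=\ell_j(v)$ for all $j<i$, or (2) $k(u)<k(v)$ and $\ell_j(u)=\ell_j(v)$ for all $j\le k(u)$. -}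

module Defs where

open import Data.Nat using (ℕ; _<_; _≤_)
open import Data.Fin using (Fin)
open import Data.List using (List; []; _∷_; map; _++_)
open import Data.Product using (_×_; ∃)
open import Relation.Nullary using (¬_)
open import Relation.Binary.PropositionalEquality using (_≡_; _≢_)
open import Relation.Binary.Construct.Closure.ReflexiveTransitive using (Star)
open import Relation.Binary.Construct.Closure.Transitive using (TransClosure)

-- ℤ⁺ ∪ {∞}: ranks.  (positivity of finite ranks is imposed as a hypothesis)
data ℕ∞ : Set where
  fin : ℕ → ℕ∞
  ∞   : ℕ∞

data _<∞_ : ℕ∞ → ℕ∞ → Set where
  fin<fin : ∀ {m k} → m < k → fin m <∞ fin k
  fin<∞   : ∀ {m} → fin m <∞ ∞

data _≤∞_ : ℕ∞ → ℕ∞ → Set where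
  fin≤fin : ∀ {m k} → m ≤ k → fin m ≤∞ fin k
  ≤∞-top  : ∀ {x} → x ≤∞ ∞

Graph : ℕ → Set₁
Graph n = Fin n → Fin n → Set

Path : ∀ {n} → Graph n → Fin n → Fin n → Set
Path E = Star E

Acyclic : ∀ {n} → Graph n → Set
Acyclic {n} E = ∀ (v : Fin n) → ¬ TransClosure E v v

ValidRanking : ∀ {n} → (Fin n → Set) → (Fin n → ℕ∞) → Set
ValidRanking {n} L r =
    (∀ v → L v → ∃ λ k → (1 ≤ k) × (r v ≡ fin k))
  × (∀ v → ¬ L v → r v ≡ ∞)
  × (∀ u v → L u → L v → r u ≡ r v → u ≡ v)

-- LabelFrom E L r v A ls : ls is the sequence ℓ_i, ℓ_{i+1}, ... produced by the
-- iterative procedure starting from the set A = A_i (a predicate on vertices):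
-- if A is empty the sequence stops; otherwise ℓ_i is the vertex of A of
-- minimum rank and A_{i+1} = (D(ℓ_i, v) \ {ℓ_i}) ∩ L.
data LabelFrom {n} (E : Graph n) (L : Fin n → Set) (r : Fin n → ℕ∞) (v : Fin n)
       : (Fin n → Set) → List (Fin n) → Set₁ where
  done : ∀ {A} → (∀ w → ¬ A w) → LabelFrom E L r v A []
  step : ∀ {A} {l} {ls} →
         A l →
         (∀ w → A w → r l ≤∞ r w) →
         LabelFrom E L r v
           (λ w → (Path E l w × Path E w v) × (w ≢ l) × L w) ls →
         LabelFrom E L r v A (l ∷ ls)

-- IsLabel E L r v ls : ls = ℓ(v) = (ℓ_1(v), ..., ℓ_{k(v)}(v)),
-- starting from A_1(v) = P(v) ∩ L.
IsLabel : ∀ {n} → Graph n → (Fin n → Set) → (Fin n → ℕ∞) → Fin n → List (Fin n) → Set₁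
IsLabel E L r v ls = LabelFrom E L r v (λ w → Path E w v × L w) ls

rankSeq : ∀ {n} → (Fin n → ℕ∞) → List (Fin n) → List ℕ∞
rankSeq r ls = map r ls ++ (∞ ∷ [])

data _>lex_ : List ℕ∞ → List ℕ∞ → Set where
  here  : ∀ {x y xs ys} → y <∞ x → (x ∷ xs) >lex (y ∷ ys)
  there : ∀ {x y xs ys} → x ≡ y → xs >lex ys → (x ∷ xs) >lex (y ∷ ys)

-- If v reaches u, every candidate set A_i(v) is contained in A_i(u) as long as the
-- labels agree, since a path into v extends to a path into u.  Hence at the first
-- position where the labels differ, ℓ_i(u) is chosen among a superset and has rank
-- at most r(ℓ_i(v)) (and u's label cannot stop while v's continues); with ranks
-- injective on L, ρ(u) ≤lex ρ(v).
module Submission where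

open import Defs
open import Data.Nat using (ℕ)
open import Data.Nat.Properties using (<⇒≱)
open import Data.Fin using (Fin)
open import Data.List using (List; []; _∷_)
open import Data.Product using (_×_; _,_; proj₁; proj₂)
open import Relation.Nullary using (¬_)
open import Relation.Unary using (_⊆_)
open import Relation.Binary.PropositionalEquality using (_≡_; _≢_; refl)
open import Relation.Binary.Construct.Closure.ReflexiveTransitive using (_◅◅_)

<∞⇒≱∞ : ∀ {x y} → x <∞ y → ¬ (y ≤∞ x)
<∞⇒≱∞ (fin<fin m<k) (fin≤fin k≤m) = <⇒≱ m<k k≤m

∞≮∞ : ∀ {x} → ¬ (∞ <∞ x)
∞≮∞ ()

≯lex-∞ : ∀ {xs} → ¬ (xs >lex (∞ ∷ []))
≯lex-∞ (here ∞<x) = ∞≮∞ ∞<x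
≯lex-∞ (there _ ())

module _ {n} (E : Graph n) (L : Fin n → Set) (r : Fin n → ℕ∞)
         (r-injective : ∀ u v → L u → L v → r u ≡ r v → u ≡ v) where

  Next : Fin n → Fin n → Fin n → Set
  Next v l w = (Path E l w × Path E w v) × (w ≢ l) × L w

  Next-mono : ∀ {u v l} → Path E v u → Next v l ⊆ Next u l
  Next-mono v⇝u ((l⇝w , w⇝v) , w≢l , Lw) = (l⇝w , w⇝v ◅◅ v⇝u) , w≢l , Lw

  Next⊆L : ∀ {v l} → Next v l ⊆ L
  Next⊆L (_ , _ , Lw) = Lw

  labelFrom-≯lex : ∀ {u v A B ℓA ℓB} → Path E v u → A ⊆ B → B ⊆ L →
                   LabelFrom E L r v A ℓA → LabelFrom E L r u B ℓB →
                   ¬ (rankSeq r ℓB >lex rankSeq r ℓA)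
  labelFrom-≯lex _ _ _ (done _) _ ρB>ρA = ≯lex-∞ ρB>ρA
  labelFrom-≯lex _ A⊆B _ (step Aa _ _) (done B-empty) _ = B-empty _ (A⊆B Aa)
  labelFrom-≯lex _ A⊆B _ (step Aa _ _) (step _ b-min _) (here ra<rb) =
    <∞⇒≱∞ ra<rb (b-min _ (A⊆B Aa))
  labelFrom-≯lex v⇝u A⊆B B⊆L (step {l = a} Aa _ restA) (step {l = b} Bb _ restB) (there rb≡ra ρB>ρA)
    with r-injective b a (B⊆L Bb) (B⊆L (A⊆B Aa)) rb≡ra
  ... | refl = labelFrom-≯lex v⇝u (Next-mono v⇝u) Next⊆L restA restB ρB>ρA

theorem1 : ∀ (n : ℕ) (E : Graph n) → Acyclic E →
           ∀ (L : Fin n → Set) (r : Fin n → ℕ∞) → ValidRanking L r →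
           ∀ (u v : Fin n) (ℓu ℓv : List (Fin n)) →
           IsLabel E L r u ℓu → IsLabel E L r v ℓv →
           rankSeq r ℓu >lex rankSeq r ℓv →
           ¬ Path E v u
theorem1 n E _ L r (_ , _ , r-injective) u v ℓu ℓv label-u label-v ρu>ρv v⇝u =
  labelFrom-≯lex E L r r-injective v⇝u extend proj₂ label-v label-u ρu>ρv
  where
    extend : (λ w → Path E w v × L w) ⊆ (λ w → Path E w u × L w)
    extend (w⇝v , Lw) = w⇝v ◅◅ v⇝u , Lw
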